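{- Let $n\in\mathbb{N}$, let $\mathcal{F}$ be a shellable family of subsets of $[n]$ with $|\mathcal{F}|=n$, and let $t$ be the (unique) transversal of $\mathcal{F}$. Let $S\subseteq[n]$ be the set of elements $k\in[n]$ such that $k\in F$ for exactly one member $F$ of $\mathcal{F}$, and let $m$ be an integer with $n-|S|+1\le m\le n$. Then the average value of $A_{n,m}(f)$ over all configurations $f$ of $t$ satisfying $A_{n,m}(f)\ge 1$ equals $$\frac{m!\,S(n,m)}{\prod_{F\in\mathcal{F}}|F|},$$ where $S(n,m)$ is the Stirling number of the second kind.
   Context: $\mathbb{N}$ denotes the positive integers and $[n]=\{1,\dots,n\}$. Families of sets are treated as multisets (members counted with multiplicity; the product $\prod_{F\in\mathcal{F}}|F|$ runs over members with multiplicity). $\mathcal{F}$ is shellable if there is an ordering $F_1,\dots,F_n$ of its members with $\left|\bigcup_{i=1}^k F_i\right|=k$ for every $k\in[n]$; such a family has exactly one transversal. A transversal of $\mathcal{F}$ is an injective map $t:\mathcal{F}\to[n]$ with $t(F)\in F$ for all $F$. A configuration of $t$ is a function $f:[n]\to\mathbb{N}$ with $f(t(F))\le|F|$ for all $F\in\mathcal{F}$. A surjective map $\sigma:[n]\to[m]$ satisfies $f$ if for every $F\in\mathcal{F}$, $\sigma(t(F))$ is the $k$-th smallest element of $\sigma(F)=\{\sigma(i):i\in F\}$, where $k=f(t(F))$. $A_{n,m}(f)$ denotes the number of surjective maps $\sigma:[n]\to[m]$ that satisfy $f$. If $X$ is the set of configurations $f$ of $t$ with $A_{n,m}(f)\ge1$,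 the average value of $A_{n,m}(f)$ over these configurations is $\frac{1}{|X|}\sum_{f\in X}A_{n,m}(f)$ if $|X|>0$, and $0$ otherwise. $S(n,m)$ is the number of set partitions of $[n]$ into $m$ nonempty blocks. -}

module Defs where

open import Data.Nat using (ℕ; zero; suc; _+_; _*_; _≤_; _≟_; _≤?_)
open import Data.Nat.Properties using () renaming (_≟_ to _≟ℕ_)
open import Data.Bool using (Bool; true; false)
open import Data.Fin using (Fin; zero; suc; toℕ; _<?_; _<_) renaming (_≤?_ to _≤ᶠ?_; _≤_ to _≤ᶠ_; _≟_ to _≟ᶠ_)
open import Data.Fin.Subset using (Subset; _∈_; ⋃; ∣_∣; _∩_)
open import Data.Fin.Subset.Properties using (_∈?_)
open import Data.Fin.Properties using (any?; all?)
open import Data.Fin.Permutation using (Permutation′; _⟨$⟩ʳ_)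
open import Data.List using (List; []; _∷_; [_]; map; concatMap; filter; length; allFin; upTo)
open import Data.Nat.ListAction using (sum; product)
open import Data.Vec using (tabulate)
open import Data.Product using (Σ; ∃; _×_; _,_)
open import Data.Product.Properties using () 
open import Relation.Nullary using (Dec; yes; no; ¬_)
open import Relation.Nullary.Decidable using (⌊_⌋; _×-dec_; _→-dec_)
open import Relation.Binary.PropositionalEquality using (_≡_)
open import Data.Integer using (+_)
open import Data.Rational using (ℚ; _/_; 0ℚ)
open import Function.Definitions using (Injective)

-- Families: a family with n members of subsets of [n] is indexed by
-- Fin n (members counted with multiplicity); [n] is Fin n.

Family : ℕ → Set
Family n = Fin n → Subset n

prefixUnion : ∀ {n} → Family n → Permutation′ n → Fin n → Subset n
prefixUnion {n} F π k =
  ⋃ (map (λ i → F (π ⟨$⟩ʳ i)) (filter (λ i → i ≤ᶠ? k) (allFin n)))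

Shellable : ∀ {n} → Family n → Set
Shellable {n} F =
  Σ (Permutation′ n) λ π → ∀ (k : Fin n) → ∣ prefixUnion F π k ∣ ≡ suc (toℕ k)

IsTransversal : ∀ {n} → Family n → (Fin n → Fin n) → Set
IsTransversal F t = Injective _≡_ _≡_ t × (∀ i → t i ∈ F i)

IsConfiguration : ∀ {n} → Family n → (Fin n → Fin n) → (Fin n → ℕ) → Set
IsConfiguration F t f = (∀ j → 1 ≤ f j) × (∀ i → f (t i) ≤ ∣ F i ∣)

isConfiguration? : ∀ {n} F t f → Dec (IsConfiguration {n} F t f)
isConfiguration? F t f =
  all? (λ j → 1 ≤? f j) ×-dec all? (λ i → f (t i) ≤? ∣ F i ∣)

image : ∀ {n m} → (Fin n → Fin m) → Subset n → Subset m
image σ P = tabulate λ v → ⌊ any? (λ j → (j ∈? P) ×-dec (σ j ≟ᶠ v)) ⌋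

below : ∀ {m} → Fin m → Subset m
below v = tabulate λ w → ⌊ w <? v ⌋

IsKthSmallest : ∀ {m} → ℕ → Fin m → Subset m → Set
IsKthSmallest k x Q = x ∈ Q × suc ∣ Q ∩ below x ∣ ≡ k

isKthSmallest? : ∀ {m} k x Q → Dec (IsKthSmallest {m} k x Q)
isKthSmallest? k x Q = (x ∈? Q) ×-dec (suc ∣ Q ∩ below x ∣ ≟ℕ k)

Satisfies : ∀ {n m} → Family n → (Fin n → Fin n) → (Fin n → ℕ)
          → (Fin n → Fin m) → Set
Satisfies F t f σ = ∀ i → IsKthSmallest (f (t i)) (σ (t i)) (image σ (F i))

satisfies? : ∀ {n m} F t f σ → Dec (Satisfies {n} {m} F t f σ)
satisfies? F t f σ = all? λ i → isKthSmallest? (f (t i)) (σ (t i)) (image σ (F i))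

IsSurjective : ∀ {n m} → (Fin n → Fin m) → Set
IsSurjective {n} {m} σ = ∀ (v : Fin m) → ∃ λ (j : Fin n) → σ j ≡ v

isSurjective? : ∀ {n m} σ → Dec (IsSurjective {n} {m} σ)
isSurjective? σ = all? λ v → any? λ j → σ j ≟ᶠ v

extend : ∀ {n} {A : Set} → A → (Fin n → A) → Fin (suc n) → A
extend a g zero    = a
extend a g (suc i) = g i

funs : ∀ {A : Set} (n : ℕ) → List A → List (Fin n → A)
funs zero    xs = [ (λ ()) ]
funs (suc n) xs = concatMap (λ a → map (extend a) (funs n xs)) xs

A : ∀ {n} (m : ℕ) → Family n → (Fin n → Fin n) → (Fin n → ℕ) → ℕ
A {n} m F t f =
  length (filter (λ σ → isSurjective? σ ×-dec satisfies? F t f σ)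
                 (funs n (allFin m)))

-- The set X of configurations f of t with A_{n,m}(f) ≥ 1.  Every
-- configuration takes values in {1,…,n} (t is a bijection of [n] and
-- |F| ≤ n), so enumerating functions with values in {1,…,n} is exhaustive.
configsX : ∀ {n} (m : ℕ) → Family n → (Fin n → Fin n) → List (Fin n → ℕ)
configsX {n} m F t =
  filter (λ f → isConfiguration? F t f ×-dec (1 ≤? A m F t f))
         (funs n (map suc (upTo n)))

-- Division of naturals into ℚ (with x / 0 = 0, never used under hypotheses).
_/ℕ_ : ℕ → ℕ → ℚ
a /ℕ zero    = 0ℚ
a /ℕ suc d   = (+ a) / suc d

average : ∀ {n} (m : ℕ) → Family n → (Fin n → Fin n) → ℚ
average m F t =
  sum (map (A m F t) (configsX m F t)) /ℕ length (configsX m F t)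

occurrences : ∀ {n} → Family n → Fin n → ℕ
occurrences {n} F k = length (filter (λ i → k ∈? F i) (allFin n))

S : ∀ {n} → Family n → Subset n
S F = tabulate λ k → ⌊ occurrences F k ≟ℕ 1 ⌋

prodSizes : ∀ {n} → Family n → ℕ
prodSizes {n} F = product (map (λ i → ∣ F i ∣) (allFin n))

stirling2 : ℕ → ℕ → ℕ
stirling2 zero    zero    = 1
stirling2 zero    (suc k) = 0
stirling2 (suc n) zero    = 0
stirling2 (suc n) (suc k) = suc k * stirling2 n (suc k) + stirling2 n k

{-# OPTIONS --safe #-}
module Submission where

-- Every surjection σ : [n] → [m] satisfies exactly one configuration: f (t F) has to be the rank of
-- σ (t F) in σ (F), and as t is a bijection these ranks determine f. Summing A over all configurations
-- therefore counts surjections, m! S(n,m), and it remains to see that each of the ∏ |F| configurations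
-- (1 ≤ f (t F) ≤ |F| for every member F) is satisfied by some surjection, so that X contains them all.
-- Along the shelling order every member brings exactly one new element, its transversal element, so a
-- linear order with the prescribed ranks is built by inserting that element just above f (t F) - 1 of
-- the other elements of F. An element of S lies only in the member whose transversal element it is;
-- merging n - m of them (all below the maximum) with the next element above them preserves every rank
-- and leaves a surjection onto [m].

open import Defs
open import Data.Bool using (true; false; if_then_else_)
open import Data.Nat
  using (ℕ; zero; suc; pred; _+_; _*_; _∸_; _≤_; _<_; z≤n; s≤s; s≤s⁻¹; _≤?_; _<?_; _⊓_; _!; >-nonZero)
  renaming (_≟_ to _≟ℕ_)
open import Data.Nat.Properties hiding (_≟_)
open import Data.Nat.ListAction using (sum; product)
open import Data.Nat.Tactic.RingSolver using (solve-∀)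
open import Data.List using (List; []; _∷_; [_]; _++_; map; concat; concatMap; filter; length; take; tabulate; allFin; upTo)
open import Data.List.Properties
  using (map-cong; map-cong-local; map-tabulate; length-++; length-take; length-tabulate; upTo-∷ʳ;
         filter-all; filter-none; filter-some; filter-complete; filter-≐; filter-++)
open import Data.List.Extrema.Nat using (argmax; f[xs]≤f[argmax])
open import Data.List.Membership.Propositional using (lose) renaming (_∈_ to _∈ˡ_)
open import Data.List.Membership.Propositional.Properties
  using (∈-allFin; ∈-filter⁺; ∈-filter⁻; ∈-map⁺; ∈-concat⁺′; ∈-upTo⁺)
open import Data.List.Relation.Binary.Sublist.Propositional.Properties using (Any-resp-⊆; take-⊆)
open import Data.List.Relation.Unary.All as All using (All; []; _∷_)
open import Data.List.Relation.Unary.AllPairs using ([]; _∷_)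
open import Data.List.Relation.Unary.Any as Any using (here; there)
open import Data.List.Relation.Unary.Unique.Propositional using (Unique)
open import Data.List.Relation.Unary.Unique.Propositional.Properties using (allFin⁺; filter⁺; take⁺; upTo⁺; map⁺)
open import Data.Fin as Fin using (Fin; zero; suc; toℕ; fromℕ<; _≟_) renaming (_≤?_ to _≤ᶠ?_; _<?_ to _<ᶠ?_)
open import Data.Fin.Properties
  using (all?; toℕ-injective; toℕ-fromℕ<; toℕ<n) renaming (any? to anyᶠ?; suc-injective to fsuc-injective)
open import Data.Fin.Subset using (Subset; _∈_; _∉_; _∩_; ⋃; ∣_∣)
open import Data.Fin.Subset.Properties
  using (_∈?_; drop-there; x∈p∩q⁺; x∈p∩q⁻; x∈p∪q⁺; p∩q⊆p; p⊂q⇒∣p∣<∣q∣; ∣p∣≤n)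
open import Data.Fin.Permutation using (Permutation′; permutation; _⟨$⟩ʳ_; _⟨$⟩ˡ_; inverseˡ; inverseʳ)
import Data.Vec as Vec
open import Data.Vec.Properties using ([]=⇒lookup; lookup⇒[]=; lookup∘tabulate; tabulate-cong)
open import Data.Product using (∃; _×_; _,_; proj₁; proj₂)
open import Data.Sum using (_⊎_; inj₁; inj₂)
open import Function using (_∘_; id; mk⇔)
open import Level using (0ℓ)
open import Relation.Nullary using (Dec; yes; no; ¬_; contradiction)
open import Relation.Nullary.Decidable using (_×-dec_; ¬?; ⌊_⌋; does; dec-true; dec-false; does-⇔; isYes≗does)
open import Relation.Unary using (Pred; Decidable; _⊆_; _≐_; ∁)
open import Relation.Unary.Properties using (_∩?_; _∪?_; ∁?; U?)
open import Relation.Binary.Definitions using (DecidableEquality; tri<; tri≈; tri>)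
open import Relation.Binary.PropositionalEquality hiding ([_])
import Algebra.Properties.CommutativeMonoid.Sum as CommutativeMonoidSum

𝟙 : {X : Set} → Dec X → ℕ
𝟙 (yes _) = 1
𝟙 (no _)  = 0

module _ {X : Set} where

  private variable
    P Q : Pred X 0ℓ

  count : Decidable P → List X → ℕ
  count P? xs = length (filter P? xs)

  count-∷ : (P? : Decidable P) (x : X) (xs : List X) → count P? (x ∷ xs) ≡ 𝟙 (P? x) + count P? xs
  count-∷ P? x xs with P? x
  ... | yes _ = refl
  ... | no _  = refl

  count-cong : (P? : Decidable P) (Q? : Decidable Q) → P ≐ Q → (xs : List X) → count P? xs ≡ count Q? xs
  count-cong P? Q? P≐Q xs = cong length (filter-≐ P? Q? P≐Q xs)

  count-mono : (P? : Decidable P) (Q? : Decidable Q) → P ⊆ Q → (xs : List X) → count P? xs ≤ count Q? xs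
  count-mono P? Q? P⊆Q [] = z≤n
  count-mono P? Q? P⊆Q (x ∷ xs) with P? x | Q? x
  ... | yes _  | yes _  = s≤s (count-mono P? Q? P⊆Q xs)
  ... | yes px | no ¬qx = contradiction (P⊆Q px) ¬qx
  ... | no _   | yes _  = m≤n⇒m≤1+n (count-mono P? Q? P⊆Q xs)
  ... | no _   | no _   = count-mono P? Q? P⊆Q xs

  count-mono-< : (P? : Decidable P) (Q? : Decidable Q) → P ⊆ Q →
                 ∀ {x xs} → x ∈ˡ xs → Q x → ¬ P x → count P? xs < count Q? xs
  count-mono-< P? Q? P⊆Q {xs = y ∷ xs} (here refl) qx ¬px with P? y | Q? y
  ... | yes px | _      = contradiction px ¬px
  ... | no _   | yes _  = s≤s (count-mono P? Q? P⊆Q xs)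
  ... | no _   | no ¬qx = contradiction qx ¬qx
  count-mono-< P? Q? P⊆Q {xs = y ∷ xs} (there x∈) qx ¬px with P? y | Q? y
  ... | yes _  | yes _  = s≤s (count-mono-< P? Q? P⊆Q x∈ qx ¬px)
  ... | yes py | no ¬qy = contradiction (P⊆Q py) ¬qy
  ... | no _   | yes _  = m≤n⇒m≤1+n (count-mono-< P? Q? P⊆Q x∈ qx ¬px)
  ... | no _   | no _   = count-mono-< P? Q? P⊆Q x∈ qx ¬px

  count-none : (P? : Decidable P) (xs : List X) → All (∁ P) xs → count P? xs ≡ 0
  count-none P? xs ¬ps = cong length (filter-none P? ¬ps)

  count-pos : (P? : Decidable P) {x : X} {xs : List X} → x ∈ˡ xs → P x → 0 < count P? xs
  count-pos P? x∈ px = filter-some P? (lose x∈ px)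

  count≡length⇒∈ : (P? : Decidable P) (xs : List X) → count P? xs ≡ length xs → ∀ {x} → x ∈ˡ xs → P x
  count≡length⇒∈ P? xs eq x∈ = proj₂ (∈-filter⁻ P? {xs = xs} (subst (_ ∈ˡ_) (sym (filter-complete P? eq)) x∈))

  count-∩-∁ : (P? : Decidable P) (Q? : Decidable Q) (xs : List X) →
              count P? xs ≡ count (P? ∩? Q?) xs + count (P? ∩? ∁? Q?) xs
  count-∩-∁ P? Q? [] = refl
  count-∩-∁ P? Q? (x ∷ xs) with P? x | Q? x
  ... | yes _ | yes _ = cong suc (count-∩-∁ P? Q? xs)
  ... | yes _ | no _  = trans (cong suc (count-∩-∁ P? Q? xs)) (sym (+-suc _ _))
  ... | no _  | yes _ = count-∩-∁ P? Q? xs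
  ... | no _  | no _  = count-∩-∁ P? Q? xs

  count+count-∁ : (P? : Decidable P) (xs : List X) → count P? xs + count (∁? P?) xs ≡ length xs
  count+count-∁ P? [] = refl
  count+count-∁ P? (x ∷ xs) with P? x
  ... | yes _ = cong suc (count+count-∁ P? xs)
  ... | no _  = trans (+-suc _ _) (cong suc (count+count-∁ P? xs))

  count-∪ : (P? : Decidable P) (Q? : Decidable Q) (xs : List X) →
            count (P? ∪? Q?) xs ≤ count P? xs + count Q? xs
  count-∪ {P = P} {Q = Q} P? Q? xs = begin
    count (P? ∪? Q?) xs
      ≡⟨ count-∩-∁ (P? ∪? Q?) P? xs ⟩
    count ((P? ∪? Q?) ∩? P?) xs + count ((P? ∪? Q?) ∩? ∁? P?) xs
      ≤⟨ +-mono-≤ (count-mono _ P? proj₂ xs) (count-mono _ Q? only-Q xs) ⟩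
    count P? xs + count Q? xs
      ∎
    where
    open ≤-Reasoning
    only-Q : ∀ {x} → (P x ⊎ Q x) × ¬ P x → Q x
    only-Q (inj₁ p , ¬p) = contradiction p ¬p
    only-Q (inj₂ q , _)  = q

  count-∪-disjoint : (P? : Decidable P) (Q? : Decidable Q) → (∀ {x} → P x → ¬ Q x) → (xs : List X) →
                     count (P? ∪? Q?) xs ≡ count P? xs + count Q? xs
  count-∪-disjoint P? Q? disjoint [] = refl
  count-∪-disjoint P? Q? disjoint (x ∷ xs) with P? x | Q? x
  ... | yes p | yes q = contradiction q (disjoint p)
  ... | yes _ | no _  = cong suc (count-∪-disjoint P? Q? disjoint xs)
  ... | no _  | yes _ = trans (cong suc (count-∪-disjoint P? Q? disjoint xs)) (sym (+-suc _ _))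
  ... | no _  | no _  = count-∪-disjoint P? Q? disjoint xs

  count-++ : (P? : Decidable P) (xs ys : List X) → count P? (xs ++ ys) ≡ count P? xs + count P? ys
  count-++ P? xs ys = trans (cong length (filter-++ P? xs ys)) (length-++ (filter P? xs))

  count-unique≤1 : (P? : Decidable P) {xs : List X} → Unique xs → (∀ {x y} → P x → P y → x ≡ y) →
                   count P? xs ≤ 1
  count-unique≤1 P? {[]} _ _ = z≤n
  count-unique≤1 P? {x ∷ xs} (x∉xs ∷ unique) P-unique with P? x
  ... | no _   = count-unique≤1 P? unique P-unique
  ... | yes px = s≤s (≤-reflexive (count-none P? xs (All.map (λ x≢y py → x≢y (P-unique px py)) x∉xs)))

  count-unique≡1 : (P? : Decidable P) {xs : List X} → Unique xs → (∀ {x y} → P x → P y → x ≡ y) →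
                   ∀ {x} → x ∈ˡ xs → P x → count P? xs ≡ 1
  count-unique≡1 P? unique P-unique x∈ px =
    ≤-antisym (count-unique≤1 P? unique P-unique) (count-pos P? x∈ px)

  sum-map-const : (c : ℕ) (xs : List X) → sum (map (λ _ → c) xs) ≡ length xs * c
  sum-map-const c []       = refl
  sum-map-const c (x ∷ xs) = cong (c +_) (sum-map-const c xs)

  sum-map-cong : (f g : X → ℕ) (xs : List X) → (∀ {x} → x ∈ˡ xs → f x ≡ g x) → sum (map f xs) ≡ sum (map g xs)
  sum-map-cong f g xs f≗g = cong sum (map-cong-local (All.tabulate f≗g))

  sum-map-+ : (f g : X → ℕ) (xs : List X) → sum (map (λ x → f x + g x) xs) ≡ sum (map f xs) + sum (map g xs)
  sum-map-+ f g []       = refl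
  sum-map-+ f g (x ∷ xs) = trans (cong (f x + g x +_) (sum-map-+ f g xs)) (interchange (f x) (g x) _ _)
    where
    interchange : ∀ a b c d → a + b + (c + d) ≡ a + c + (b + d)
    interchange = solve-∀

  sum-map-𝟙 : (P? : Decidable P) (xs : List X) → sum (map (λ x → 𝟙 (P? x)) xs) ≡ count P? xs
  sum-map-𝟙 P? []       = refl
  sum-map-𝟙 P? (x ∷ xs) = trans (cong (𝟙 (P? x) +_) (sum-map-𝟙 P? xs)) (sym (count-∷ P? x xs))

  sum-map-𝟙* : (P? : Decidable P) (f : X → ℕ) (xs : List X) →
               sum (map (λ x → 𝟙 (P? x) * f x) xs) ≡ sum (map f (filter P? xs))
  sum-map-𝟙* P? f [] = refl
  sum-map-𝟙* P? f (x ∷ xs) with P? x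
  ... | yes _ = cong₂ _+_ (+-identityʳ (f x)) (sum-map-𝟙* P? f xs)
  ... | no _  = sum-map-𝟙* P? f xs

  sum-map-filter : (P? : Decidable P) (f : X → ℕ) (xs : List X) →
                   (∀ {x} → ¬ P x → f x ≡ 0) → sum (map f (filter P? xs)) ≡ sum (map f xs)
  sum-map-filter P? f [] _ = refl
  sum-map-filter P? f (x ∷ xs) f≡0 with P? x
  ... | yes _  = cong (f x +_) (sum-map-filter P? f xs f≡0)
  ... | no ¬px = trans (sum-map-filter P? f xs f≡0) (cong (_+ sum (map f xs)) (sym (f≡0 ¬px)))

count-map : {X Y : Set} {P : Pred Y 0ℓ} (P? : Decidable P) (f : X → Y) (xs : List X) →
            count P? (map f xs) ≡ count (λ x → P? (f x)) xs
count-map P? f [] = refl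
count-map P? f (x ∷ xs) with P? (f x)
... | yes _ = cong suc (count-map P? f xs)
... | no _  = count-map P? f xs

count-concatMap : {X Y : Set} {P : Pred Y 0ℓ} (P? : Decidable P) (f : X → List Y) (xs : List X) →
                  count P? (concatMap f xs) ≡ sum (map (λ x → count P? (f x)) xs)
count-concatMap P? f [] = refl
count-concatMap P? f (x ∷ xs) =
  trans (count-++ P? (f x) (concat (map f xs))) (cong (count P? (f x) +_) (count-concatMap P? f xs))

double-count : {X Y : Set} {R : X → Y → Set} (R? : ∀ x y → Dec (R x y)) (xs : List X) (ys : List Y) →
               sum (map (λ x → count (R? x) ys) xs) ≡ sum (map (λ y → count (λ x → R? x y) xs) ys)
double-count R? [] ys = sym (trans (sum-map-const 0 ys) (*-zeroʳ (length ys)))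
double-count R? (x ∷ xs) ys = begin
  count (R? x) ys + sum (map (λ x → count (R? x) ys) xs)
    ≡⟨ cong₂ _+_ (sym (sum-map-𝟙 (R? x) ys)) (double-count R? xs ys) ⟩
  sum (map (λ y → 𝟙 (R? x y)) ys) + sum (map (λ y → count (λ x → R? x y) xs) ys)
    ≡⟨ sym (sum-map-+ (λ y → 𝟙 (R? x y)) (λ y → count (λ x → R? x y) xs) ys) ⟩
  sum (map (λ y → 𝟙 (R? x y) + count (λ x → R? x y) xs) ys)
    ≡⟨ sum-map-cong _ _ ys (λ {y} _ → sym (count-∷ (λ x → R? x y) x xs)) ⟩
  sum (map (λ y → count (λ x → R? x y) (x ∷ xs)) ys)
    ∎
  where open ≡-Reasoning

map-allFin-suc : ∀ {X : Set} {n} (f : Fin (suc n) → X) → map f (allFin (suc n)) ≡ f zero ∷ map (f ∘ suc) (allFin n)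
map-allFin-suc {n = n} f = cong (f zero ∷_) (trans (map-tabulate suc f) (sym (map-tabulate id (f ∘ suc))))

count-allFin-suc : ∀ {n} {P : Pred (Fin (suc n)) 0ℓ} (P? : Decidable P) →
                   count P? (allFin (suc n)) ≡ 𝟙 (P? zero) + count (P? ∘ suc) (allFin n)
count-allFin-suc {n} P? = trans (cong (count P? ∘ (zero ∷_)) (sym (map-tabulate id suc)))
                                (trans (count-∷ P? zero _) (cong (𝟙 (P? zero) +_) (count-map P? suc (allFin n))))

count-allFin≡1⇒unique : ∀ {n} {P : Pred (Fin n) 0ℓ} (P? : Decidable P) → count P? (allFin n) ≡ 1 →
                        ∀ {i j} → P i → P j → i ≡ j
count-allFin≡1⇒unique {n} P? count≡1 {i} {j} pi pj with i ≟ j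
... | yes i≡j = i≡j
... | no i≢j  = contradiction (begin
  2                                                                       ≤⟨ +-mono-≤ i-counted j-counted ⟩
  count (P? ∩? (_≟ i)) (allFin n) + count (P? ∩? ∁? (_≟ i)) (allFin n)    ≡⟨ count-∩-∁ P? (_≟ i) (allFin n) ⟨
  count P? (allFin n)                                                     ≡⟨ count≡1 ⟩
  1                                                                       ∎) λ { (s≤s ()) }
  where
  open ≤-Reasoning
  i-counted : 0 < count (P? ∩? (_≟ i)) (allFin n)
  i-counted = count-pos (P? ∩? (_≟ i)) (∈-allFin i) (pi , refl)
  j-counted : 0 < count (P? ∩? ∁? (_≟ i)) (allFin n)
  j-counted = count-pos (P? ∩? ∁? (_≟ i)) (∈-allFin j) (pj , i≢j ∘ sym)

count-allFin-≤ : ∀ {n} (k : Fin n) → count (_≤ᶠ? k) (allFin n) ≡ suc (toℕ k)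
count-allFin-≤ {suc n} zero = trans (count-allFin-suc {n} (_≤ᶠ? zero {n}))
  (cong suc (count-none (λ i → suc i ≤ᶠ? zero {n}) (allFin n) (All.tabulate λ _ ())))
count-allFin-≤ {suc n} (suc k) = trans (count-allFin-suc {n} (_≤ᶠ? suc k))
  (cong suc (trans (count-cong (λ i → suc i ≤ᶠ? suc k) (_≤ᶠ? k) ((λ { (s≤s i≤k) → i≤k }) , s≤s) (allFin n))
                   (count-allFin-≤ k)))

∣p∣≡count : ∀ {n} (p : Subset n) → ∣ p ∣ ≡ count (_∈? p) (allFin n)
∣p∣≡count Vec.[]      = refl
∣p∣≡count q@(b Vec.∷ p) = sym (begin
  count (_∈? q) (allFin (suc _))
    ≡⟨ count-allFin-suc (_∈? q) ⟩
  𝟙 (zero ∈? q) + count (λ i → suc i ∈? q) (allFin _)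
    ≡⟨ cong (𝟙 (zero ∈? q) +_) (count-cong _ (_∈? p) (drop-there , Vec.there) (allFin _)) ⟩
  𝟙 (zero ∈? q) + count (_∈? p) (allFin _)
    ≡⟨ cong (𝟙 (zero ∈? q) +_) (∣p∣≡count p) ⟨
  𝟙 (zero ∈? q) + ∣ p ∣
    ≡⟨ head b ⟩
  ∣ q ∣
    ∎)
  where
  open ≡-Reasoning
  head : ∀ b → 𝟙 (zero ∈? (b Vec.∷ p)) + ∣ p ∣ ≡ ∣ b Vec.∷ p ∣
  head true  = refl
  head false = refl

∈-tabulate⌊⌋⁺ : ∀ {n} {P : Pred (Fin n) 0ℓ} (P? : Decidable P) {i} → P i → i ∈ Vec.tabulate (⌊_⌋ ∘ P?)
∈-tabulate⌊⌋⁺ P? {i} pi with P? i in eq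
... | yes _ = lookup⇒[]= i _ (trans (lookup∘tabulate (⌊_⌋ ∘ P?) i) (cong ⌊_⌋ eq))
... | no ¬pi = contradiction pi ¬pi

∈-tabulate⌊⌋⁻ : ∀ {n} {P : Pred (Fin n) 0ℓ} (P? : Decidable P) {i} → i ∈ Vec.tabulate (⌊_⌋ ∘ P?) → P i
∈-tabulate⌊⌋⁻ P? {i} i∈ with P? i | trans (sym (lookup∘tabulate (⌊_⌋ ∘ P?) i)) ([]=⇒lookup i∈)
... | yes pi | _  = pi
... | no _   | ()

Image : ∀ {a b} → (Fin a → Fin b) → Pred (Fin a) 0ℓ → Pred (Fin b) 0ℓ
Image e D y = ∃ λ x → D x × e x ≡ y

image? : ∀ {a b} (e : Fin a → Fin b) {D : Pred (Fin a) 0ℓ} → Decidable D → Decidable (Image e D)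
image? e D? y = anyᶠ? λ x → D? x ×-dec (e x ≟ y)

InjectiveOn : ∀ {a b} → (Fin a → Fin b) → Pred (Fin a) 0ℓ → Set
InjectiveOn e D = ∀ {x x′} → D x → D x′ → e x ≡ e x′ → x ≡ x′

count-×-≟ : ∀ {b} {X : Set} (d : Dec X) (c : Fin b) → count (λ y → d ×-dec (c ≟ y)) (allFin b) ≡ 𝟙 d
count-×-≟ {b} (yes x) c = count-unique≡1 (λ y → yes x ×-dec (c ≟ y)) (allFin⁺ b)
                                          (λ (_ , eq) (_ , eq′) → trans (sym eq) eq′) (∈-allFin c) (x , refl)
count-×-≟ {b} (no ¬x) c = count-none (λ y → no ¬x ×-dec (c ≟ y)) (allFin b) (All.tabulate λ _ (x , _) → ¬x x)

module _ {a b : ℕ} (e : Fin (suc a) → Fin b) {D : Pred (Fin (suc a)) 0ℓ} (D? : Decidable D) where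

  private
    Head : Pred (Fin b) 0ℓ
    Head y = D zero × e zero ≡ y

    head? : Decidable Head
    head? y = D? zero ×-dec (e zero ≟ y)

    tail? : Decidable (Image (e ∘ suc) (D ∘ suc))
    tail? = image? (e ∘ suc) (D? ∘ suc)

    Image-suc : Image e D ≐ (λ y → Head y ⊎ Image (e ∘ suc) (D ∘ suc) y)
    Image-suc = (λ { (zero , d , eq) → inj₁ (d , eq) ; (suc x , d , eq) → inj₂ (x , d , eq) })
              , (λ { (inj₁ (d , eq)) → zero , d , eq ; (inj₂ (x , d , eq)) → suc x , d , eq })

    count-head : count head? (allFin b) ≡ 𝟙 (D? zero)
    count-head = count-×-≟ (D? zero) (e zero)

  count-image-suc≤ : count (image? e D?) (allFin b) ≤ 𝟙 (D? zero) + count (image? (e ∘ suc) (D? ∘ suc)) (allFin b)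
  count-image-suc≤ = begin
    count (image? e D?) (allFin b)                                 ≡⟨ count-cong _ _ Image-suc (allFin b) ⟩
    count (head? ∪? tail?) (allFin b)                              ≤⟨ count-∪ head? tail? (allFin b) ⟩
    count head? (allFin b) + count tail? (allFin b)                ≡⟨ cong (_+ count tail? (allFin b)) count-head ⟩
    𝟙 (D? zero) + count (image? (e ∘ suc) (D? ∘ suc)) (allFin b)   ∎
    where open ≤-Reasoning

  count-image-suc : InjectiveOn e D →
    count (image? e D?) (allFin b) ≡ 𝟙 (D? zero) + count (image? (e ∘ suc) (D? ∘ suc)) (allFin b)
  count-image-suc inj = begin
    count (image? e D?) (allFin b)                                 ≡⟨ count-cong _ _ Image-suc (allFin b) ⟩
    count (head? ∪? tail?) (allFin b)                              ≡⟨ count-∪-disjoint head? tail? disjoint (allFin b) ⟩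
    count head? (allFin b) + count tail? (allFin b)                ≡⟨ cong (_+ count tail? (allFin b)) count-head ⟩
    𝟙 (D? zero) + count (image? (e ∘ suc) (D? ∘ suc)) (allFin b)   ∎
    where
    open ≡-Reasoning
    disjoint : ∀ {y} → Head y → ¬ Image (e ∘ suc) (D ∘ suc) y
    disjoint (d , eq) (x , d′ , eq′) with inj d d′ (trans eq (sym eq′))
    ... | ()

count-image≤ : ∀ {a b} (e : Fin a → Fin b) {D : Pred (Fin a) 0ℓ} (D? : Decidable D) →
               count (image? e D?) (allFin b) ≤ count D? (allFin a)
count-image≤ {zero} {b} e D? = ≤-reflexive (count-none (image? e D?) (allFin b) (All.tabulate λ _ ()))
count-image≤ {suc a} e D? = begin
  count (image? e D?) (allFin _)                                   ≤⟨ count-image-suc≤ e D? ⟩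
  𝟙 (D? zero) + count (image? (e ∘ suc) (D? ∘ suc)) (allFin _)
    ≤⟨ +-monoʳ-≤ _ (count-image≤ (e ∘ suc) (D? ∘ suc)) ⟩
  𝟙 (D? zero) + count (D? ∘ suc) (allFin a)                        ≡⟨ count-allFin-suc D? ⟨
  count D? (allFin (suc a))                                        ∎
  where open ≤-Reasoning

count-image : ∀ {a b} (e : Fin a → Fin b) {D : Pred (Fin a) 0ℓ} (D? : Decidable D) → InjectiveOn e D →
              count (image? e D?) (allFin b) ≡ count D? (allFin a)
count-image {zero} {b} e D? _ = count-none (image? e D?) (allFin b) (All.tabulate λ _ ())
count-image {suc a} e D? inj = begin
  count (image? e D?) (allFin _)                                   ≡⟨ count-image-suc e D? inj ⟩
  𝟙 (D? zero) + count (image? (e ∘ suc) (D? ∘ suc)) (allFin _)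
    ≡⟨ cong (𝟙 (D? zero) +_) (count-image (e ∘ suc) (D? ∘ suc) λ d d′ eq → fsuc-injective (inj d d′ eq)) ⟩
  𝟙 (D? zero) + count (D? ∘ suc) (allFin a)                        ≡⟨ count-allFin-suc D? ⟨
  count D? (allFin (suc a))                                        ∎
  where open ≡-Reasoning

count-image≡⇒surjective : ∀ {a b} (e : Fin a → Fin b) {D : Pred (Fin a) 0ℓ} (D? : Decidable D) →
                          count (image? e D?) (allFin b) ≡ b → ∀ y → Image e D y
count-image≡⇒surjective {b = b} e D? count≡b y =
  count≡length⇒∈ (image? e D?) (allFin b) (trans count≡b (sym (length-tabulate id))) (∈-allFin y)

injective⇒surjective : ∀ {n} (e : Fin n → Fin n) → (∀ {x x′} → e x ≡ e x′ → x ≡ x′) →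
                       ∀ y → ∃ λ x → e x ≡ y
injective⇒surjective {n} e inj y = let (x , _ , ex≡y) = count-image≡⇒surjective e U? image-full y in x , ex≡y
  where
  image-full : count (image? e U?) (allFin n) ≡ n
  image-full = trans (count-image e U? (λ _ _ → inj))
                     (trans (cong length (filter-all U? {xs = allFin n} (All.tabulate _))) (length-tabulate {n = n} id))

module _ {B : Set} where

  AllValues : ∀ {n} → (Fin n → Pred B 0ℓ) → Pred (Fin n → B) 0ℓ
  AllValues P g = ∀ j → P j (g j)

  allValues? : ∀ {n} {P : Fin n → Pred B 0ℓ} → (∀ j → Decidable (P j)) → Decidable (AllValues P)
  allValues? P? g = all? λ j → P? j (g j)

  ∈-funs : ∀ n {xs : List B} (g : Fin n → B) → (∀ j → g j ∈ˡ xs) →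
           ∃ λ g′ → g′ ∈ˡ funs n xs × (∀ j → g′ j ≡ g j)
  ∈-funs zero    g _    = (λ ()) , here refl , λ ()
  ∈-funs (suc n) {xs} g g∈ with ∈-funs n (g ∘ suc) (g∈ ∘ suc)
  ... | g′ , g′∈ , g′≗g = extend (g zero) g′
                        , ∈-concat⁺′ (∈-map⁺ (extend (g zero)) g′∈)
                                     (∈-map⁺ (λ a → map (extend a) (funs n xs)) (g∈ zero))
                        , λ { zero → refl ; (suc j) → g′≗g j }

  count-funs-allValues : ∀ n (xs : List B) {P : Fin n → Pred B 0ℓ} (P? : ∀ j → Decidable (P j)) →
                         count (allValues? P?) (funs n xs) ≡ product (map (λ j → count (P? j) xs) (allFin n))
  count-funs-allValues zero xs P? = cong length (filter-all (allValues? P?) {xs = funs zero xs} ((λ ()) ∷ []))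
  count-funs-allValues (suc n) xs P? = begin
    count (allValues? P?) (concatMap (λ a → map (extend a) (funs n xs)) xs)
      ≡⟨ count-concatMap (allValues? P?) _ xs ⟩
    sum (map (λ a → count (allValues? P?) (map (extend a) (funs n xs))) xs)
      ≡⟨ sum-map-cong _ _ xs (λ {a} _ → trans (count-map (allValues? P?) (extend a) (funs n xs)) (count-extend a)) ⟩
    sum (map (λ a → 𝟙 (P? zero a) * rest) xs)
      ≡⟨ sum-map-𝟙* (P? zero) (λ _ → rest) xs ⟩
    sum (map (λ _ → rest) (filter (P? zero) xs))
      ≡⟨ sum-map-const rest (filter (P? zero) xs) ⟩
    count (P? zero) xs * rest
      ≡⟨ cong (count (P? zero) xs *_) (count-funs-allValues n xs (P? ∘ suc)) ⟩
    count (P? zero) xs * product (map (λ j → count (P? (suc j)) xs) (allFin n))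
      ≡⟨ cong product (map-allFin-suc (λ j → count (P? j) xs)) ⟨
    product (map (λ j → count (P? j) xs) (allFin (suc n)))
      ∎
    where
    open ≡-Reasoning
    rest : ℕ
    rest = count (allValues? (P? ∘ suc)) (funs n xs)
    count-extend : ∀ a → count (λ g → allValues? P? (extend a g)) (funs n xs) ≡ 𝟙 (P? zero a) * rest
    count-extend a with P? zero a
    ... | yes pa = trans (count-cong _ _ ((λ h j → h (suc j)) , λ { h zero → pa ; h (suc j) → h j }) (funs n xs))
                         (sym (+-identityʳ rest))
    ... | no ¬pa = count-none _ (funs n xs) (All.tabulate λ _ h → ¬pa (h zero))

  count-funs-filter : ∀ n (ys : List B) {Q : Pred B 0ℓ} (Q? : Decidable Q)
                      {P : Pred (Fin n → B) 0ℓ} (P? : Decidable P) →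
                      count (P? ∩? allValues? (λ _ → Q?)) (funs n ys) ≡ count P? (funs n (filter Q? ys))
  count-funs-filter zero ys Q? P? = count-cong (P? ∩? allValues? (λ _ → Q?)) P? (proj₁ , (_, λ ())) (funs zero ys)
  count-funs-filter (suc n) ys {Q} Q? P? = begin
    count (P? ∩? allValues? (λ _ → Q?)) (concatMap (λ a → map (extend a) (funs n ys)) ys)
      ≡⟨ count-concatMap _ _ ys ⟩
    sum (map (λ a → count (P? ∩? allValues? (λ _ → Q?)) (map (extend a) (funs n ys))) ys)
      ≡⟨ sum-map-cong _ _ ys (λ {a} _ → trans (count-map _ (extend a) (funs n ys)) (count-extend a)) ⟩
    sum (map (λ a → 𝟙 (Q? a) * rest a) ys)
      ≡⟨ sum-map-𝟙* Q? rest ys ⟩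
    sum (map rest (filter Q? ys))
      ≡⟨ sum-map-cong _ _ (filter Q? ys) (λ {a} _ → count-map P? (extend a) (funs n (filter Q? ys))) ⟨
    sum (map (λ a → count P? (map (extend a) (funs n (filter Q? ys)))) (filter Q? ys))
      ≡⟨ count-concatMap P? _ (filter Q? ys) ⟨
    count P? (concatMap (λ a → map (extend a) (funs n (filter Q? ys))) (filter Q? ys))
      ∎
    where
    open ≡-Reasoning
    rest : B → ℕ
    rest a = count (λ g → P? (extend a g)) (funs n (filter Q? ys))
    count-extend : ∀ a → count (λ g → (P? ∩? allValues? (λ _ → Q?)) (extend a g)) (funs n ys) ≡ 𝟙 (Q? a) * rest a
    count-extend a = by-cases (Q? a)
      where
      by-cases : (d : Dec (Q a)) → count (λ g → (P? ∩? allValues? (λ _ → Q?)) (extend a g)) (funs n ys) ≡ 𝟙 d * rest a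
      by-cases (yes qa) = begin
        count (λ g → (P? ∩? allValues? (λ _ → Q?)) (extend a g)) (funs n ys)
          ≡⟨ count-cong _ _ ((λ (p , q) → p , q ∘ suc) , λ (p , q) → p , λ { zero → qa ; (suc j) → q j }) (funs n ys) ⟩
        count ((λ g → P? (extend a g)) ∩? allValues? (λ _ → Q?)) (funs n ys)
          ≡⟨ count-funs-filter n ys Q? (λ g → P? (extend a g)) ⟩
        rest a
          ≡⟨ +-identityʳ (rest a) ⟨
        1 * rest a
          ∎
      by-cases (no ¬qa) = count-none _ (funs n ys) (All.tabulate λ _ (_ , q) → ¬qa (q zero))

Hits : ∀ {n} {B : Set} → (Fin n → B) → Pred B 0ℓ
Hits g y = ∃ λ j → g j ≡ y

module _ {B : Set} (_≟ᴮ_ : DecidableEquality B) where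

  hits? : ∀ {n} (g : Fin n → B) → Decidable (Hits g)
  hits? g y = anyᶠ? λ j → g j ≟ᴮ y

  SurjectiveOnto : ∀ {n} → List B → Pred (Fin n → B) 0ℓ
  SurjectiveOnto ys g = All (Hits g) ys

  surjectiveOnto? : ∀ {n} (ys : List B) → Decidable (SurjectiveOnto {n} ys)
  surjectiveOnto? ys g = All.all? (hits? g) ys

  private
    _≢?_ : ∀ (y a : B) → Dec (¬ y ≡ a)
    y ≢? a = ¬? (y ≟ᴮ a)

  length-without : ∀ {ys : List B} → Unique ys → ∀ {a} → a ∈ˡ ys → suc (length (filter (_≢? a) ys)) ≡ length ys
  length-without {ys} unique {a} a∈ = begin
    suc (count (_≢? a) ys)                    ≡⟨ cong (_+ count (_≢? a) ys) a-once ⟨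
    count (_≟ᴮ a) ys + count (∁? (_≟ᴮ a)) ys  ≡⟨ count+count-∁ (_≟ᴮ a) ys ⟩
    length ys                                ∎
    where
    open ≡-Reasoning
    a-once : count (_≟ᴮ a) ys ≡ 1
    a-once = count-unique≡1 (_≟ᴮ a) unique (λ x≡a y≡a → trans x≡a (sym y≡a)) a∈ refl

  count-surjectiveOnto : ∀ n (ys : List B) → Unique ys →
                         count (surjectiveOnto? ys) (funs n ys) ≡ length ys ! * stirling2 n (length ys)
  count-surjectiveOnto zero [] _ = refl
  count-surjectiveOnto zero (y ∷ ys) _ =
    trans (count-none (surjectiveOnto? (y ∷ ys)) (funs zero (y ∷ ys)) (((λ { ((() , _) ∷ _) }) ∷ [])))
          (sym (*-zeroʳ (length (y ∷ ys) !)))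
  count-surjectiveOnto (suc n) ys unique = begin
    count (surjectiveOnto? ys) (concatMap (λ a → map (extend a) (funs n ys)) ys)
      ≡⟨ count-concatMap _ _ ys ⟩
    sum (map (λ a → count (surjectiveOnto? ys) (map (extend a) (funs n ys))) ys)
      ≡⟨ sum-map-cong _ _ ys (λ {a} a∈ → trans (count-map _ (extend a) (funs n ys)) (count-first-value a∈)) ⟩
    sum (map (λ _ → surjections n k + surjections n (k ∸ 1)) ys)
      ≡⟨ sum-map-const _ ys ⟩
    k * (surjections n k + surjections n (k ∸ 1))
      ≡⟨ surjections-suc k ⟩
    surjections (suc n) k
      ∎
    where
    open ≡-Reasoning
    k : ℕ
    k = length ys
    surjections : ℕ → ℕ → ℕ
    surjections n k = k ! * stirling2 n k

    surjections-suc : ∀ k → k * (surjections n k + surjections n (k ∸ 1)) ≡ surjections (suc n) k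
    surjections-suc zero    = refl
    surjections-suc (suc k) = distribute (suc k) (k !) (stirling2 n (suc k)) (stirling2 n k)
      where
      distribute : ∀ c f s₁ s₀ → c * (c * f * s₁ + f * s₀) ≡ c * f * (c * s₁ + s₀)
      distribute = solve-∀

    count-first-value : ∀ {a} → a ∈ˡ ys → count (λ g → surjectiveOnto? ys (extend a g)) (funs n ys) ≡
                                        surjections n k + surjections n (k ∸ 1)
    count-first-value {a} a∈ = begin
      count (λ g → surjectiveOnto? ys (extend a g)) (funs n ys)
        ≡⟨ count-cong _ (surjectiveOnto? ys′) (drop-a , add-a) (funs n ys) ⟩
      count (surjectiveOnto? ys′) (funs n ys)
        ≡⟨ count-∩-∁ (surjectiveOnto? ys′) (λ g → hits? g a) (funs n ys) ⟩
      count (surjectiveOnto? ys′ ∩? (λ g → hits? g a)) (funs n ys)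
        + count (surjectiveOnto? ys′ ∩? ∁? (λ g → hits? g a)) (funs n ys)
        ≡⟨ cong₂ _+_ (count-cong _ (surjectiveOnto? ys) (with-a , without-a) (funs n ys))
                     (count-cong _ (surjectiveOnto? ys′ ∩? allValues? (λ _ → _≢? a)) (misses-a , misses-a⁻¹) (funs n ys)) ⟩
      count (surjectiveOnto? ys) (funs n ys) + count (surjectiveOnto? ys′ ∩? allValues? (λ _ → _≢? a)) (funs n ys)
        ≡⟨ cong (count (surjectiveOnto? ys) (funs n ys) +_) (count-funs-filter n ys (_≢? a) (surjectiveOnto? ys′)) ⟩
      count (surjectiveOnto? ys) (funs n ys) + count (surjectiveOnto? ys′) (funs n ys′)
        ≡⟨ cong₂ _+_ (count-surjectiveOnto n ys unique) (count-surjectiveOnto n ys′ (filter⁺ (_≢? a) unique)) ⟩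
      surjections n k + surjections n (length ys′)
        ≡⟨ cong (λ l → surjections n k + surjections n l) (cong (_∸ 1) (length-without unique a∈)) ⟩
      surjections n k + surjections n (k ∸ 1)
        ∎
      where
      ys′ : List B
      ys′ = filter (_≢? a) ys
      ∈ys′⁻ : ∀ {y} → y ∈ˡ ys′ → y ∈ˡ ys × ¬ y ≡ a
      ∈ys′⁻ = ∈-filter⁻ (_≢? a) {xs = ys}
      drop-a : ∀ {g} → SurjectiveOnto ys (extend a g) → SurjectiveOnto ys′ g
      drop-a {g} onto = All.tabulate λ y∈ → hit-tail (All.lookup onto (proj₁ (∈ys′⁻ y∈))) (proj₂ (∈ys′⁻ y∈))
        where
        hit-tail : ∀ {y} → Hits (extend a g) y → ¬ y ≡ a → Hits g y
        hit-tail (zero , a≡y)  y≢a = contradiction (sym a≡y) y≢a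
        hit-tail (suc j , g≡y) _   = j , g≡y
      add-a : ∀ {g} → SurjectiveOnto ys′ g → SurjectiveOnto ys (extend a g)
      add-a {g} onto = All.tabulate λ {y} y∈ → hit (y ≟ᴮ a) y∈
        where
        hit : ∀ {y} → Dec (y ≡ a) → y ∈ˡ ys → Hits (extend a g) y
        hit (yes y≡a) _  = zero , sym y≡a
        hit (no y≢a)  y∈ = let (j , g≡y) = All.lookup onto (∈-filter⁺ (_≢? a) y∈ y≢a) in suc j , g≡y
      with-a : ∀ {g} → SurjectiveOnto ys′ g × Hits g a → SurjectiveOnto ys g
      with-a {g} (onto , hit-a) = All.tabulate λ {y} y∈ → hit (y ≟ᴮ a) y∈
        where
        hit : ∀ {y} → Dec (y ≡ a) → y ∈ˡ ys → Hits g y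
        hit (yes refl) _  = hit-a
        hit (no y≢a)   y∈ = All.lookup onto (∈-filter⁺ (_≢? a) y∈ y≢a)
      without-a : ∀ {g} → SurjectiveOnto ys g → SurjectiveOnto ys′ g × Hits g a
      without-a onto = All.tabulate (λ y∈ → All.lookup onto (proj₁ (∈ys′⁻ y∈))) , All.lookup onto a∈
      misses-a : ∀ {g} → SurjectiveOnto ys′ g × ¬ Hits g a → SurjectiveOnto ys′ g × AllValues (λ _ y → ¬ y ≡ a) g
      misses-a (onto , miss) = onto , λ j g≡a → miss (j , g≡a)
      misses-a⁻¹ : ∀ {g} → SurjectiveOnto ys′ g × AllValues (λ _ y → ¬ y ≡ a) g → SurjectiveOnto ys′ g × ¬ Hits g a
      misses-a⁻¹ (onto , miss) = onto , λ (j , g≡a) → miss j g≡a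

count-surjective : ∀ n m → count (isSurjective? {n} {m}) (funs n (allFin m)) ≡ m ! * stirling2 n m
count-surjective n m = begin
  count isSurjective? (funs n (allFin m))
    ≡⟨ count-cong isSurjective? (surjectiveOnto? _≟_ (allFin m)) ((λ onto → All.tabulate λ {y} _ → onto y)
                                                               , λ onto y → All.lookup onto (∈-allFin y)) (funs n (allFin m)) ⟩
  count (surjectiveOnto? _≟_ (allFin m)) (funs n (allFin m))
    ≡⟨ count-surjectiveOnto _≟_ n (allFin m) (allFin⁺ m) ⟩
  length (allFin m) ! * stirling2 n (length (allFin m))
    ≡⟨ cong (λ k → k ! * stirling2 n k) (length-tabulate {n = m} id) ⟩
  m ! * stirling2 n m
    ∎
  where open ≡-Reasoning

rank : ∀ {n m} → (Fin n → Fin m) → Subset n → Fin n → ℕ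
rank σ P x = suc ∣ image σ P ∩ below (σ x) ∣

module _ {n m : ℕ} (σ : Fin n → Fin m) (P : Subset n) where

  ∈-image⁺ : ∀ {x} → x ∈ P → σ x ∈ image σ P
  ∈-image⁺ {x} x∈P = ∈-tabulate⌊⌋⁺ (image? σ (_∈? P)) (x , x∈P , refl)

  ∈-image⁻ : ∀ {v} → v ∈ image σ P → Image σ (_∈ P) v
  ∈-image⁻ = ∈-tabulate⌊⌋⁻ (image? σ (_∈? P))

  ∣image∣≤∣P∣ : ∣ image σ P ∣ ≤ ∣ P ∣
  ∣image∣≤∣P∣ = begin
    ∣ image σ P ∣                            ≡⟨ ∣p∣≡count (image σ P) ⟩
    count (_∈? image σ P) (allFin m)
      ≡⟨ count-cong _ (image? σ (_∈? P)) (∈-image⁻ , λ { (_ , x∈P , refl) → ∈-image⁺ x∈P }) (allFin m) ⟩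
    count (image? σ (_∈? P)) (allFin m)      ≤⟨ count-image≤ σ (_∈? P) ⟩
    count (_∈? P) (allFin n)                 ≡⟨ ∣p∣≡count P ⟨
    ∣ P ∣                                    ∎
    where open ≤-Reasoning

  rank≤∣P∣ : ∀ {x} → x ∈ P → rank σ P x ≤ ∣ P ∣
  rank≤∣P∣ {x} x∈P = ≤-trans (p⊂q⇒∣p∣<∣q∣ (p∩q⊆p _ _ , σ x , ∈-image⁺ x∈P , not-below)) ∣image∣≤∣P∣
    where
    not-below : σ x ∉ image σ P ∩ below (σ x)
    not-below σx∈ = <-irrefl refl (∈-tabulate⌊⌋⁻ (_<ᶠ? σ x) (proj₂ (x∈p∩q⁻ (image σ P) _ σx∈)))

module _ {n m : ℕ} {σ σ′ : Fin n → Fin m} (σ≗σ′ : ∀ j → σ j ≡ σ′ j) where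

  image-resp-≗ : ∀ P → image σ P ≡ image σ′ P
  image-resp-≗ P = tabulate-cong λ v →
    trans (isYes≗does _) (trans (does-⇔ (mk⇔ (λ (j , j∈ , eq) → j , j∈ , trans (sym (σ≗σ′ j)) eq)
                                             (λ (j , j∈ , eq) → j , j∈ , trans (σ≗σ′ j) eq))
                                        (image? σ (_∈? P) v) (image? σ′ (_∈? P) v))
                                (sym (isYes≗does _)))

  Satisfies-resp-≗ : ∀ (F : Family n) t f → Satisfies F t f σ → Satisfies F t f σ′
  Satisfies-resp-≗ F t f sat i = subst₂ (IsKthSmallest (f (t i))) (σ≗σ′ (t i)) (image-resp-≗ (F i)) (sat i)

  IsSurjective-resp-≗ : IsSurjective σ → IsSurjective σ′
  IsSurjective-resp-≗ onto v = let (j , eq) = onto v in j , trans (sym (σ≗σ′ j)) eq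

oneTo : ℕ → List ℕ
oneTo n = map suc (upTo n)

count-upTo-< : ∀ n b → count (_<? b) (upTo n) ≡ b ⊓ n
count-upTo-< zero b = sym (⊓-zeroʳ b)
count-upTo-< (suc n) b = begin
  count (_<? b) (upTo (suc n))
    ≡⟨ cong (count (_<? b)) (upTo-∷ʳ n) ⟨
  count (_<? b) (upTo n ++ [ n ])
    ≡⟨ count-++ (_<? b) (upTo n) [ n ] ⟩
  count (_<? b) (upTo n) + count (_<? b) [ n ]
    ≡⟨ cong₂ _+_ (count-upTo-< n b) (trans (count-∷ (_<? b) n []) (+-identityʳ _)) ⟩
  b ⊓ n + 𝟙 (n <? b)
    ≡⟨ last (n <? b) ⟩
  b ⊓ suc n
    ∎
  where
  open ≡-Reasoning
  last : (d : Dec (n < b)) → b ⊓ n + 𝟙 d ≡ b ⊓ suc n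
  last (yes n<b) = trans (cong (_+ 1) (m≥n⇒m⊓n≡n (<⇒≤ n<b))) (trans (+-comm n 1) (sym (m≥n⇒m⊓n≡n n<b)))
  last (no n≮b)  = trans (+-identityʳ _)
                         (trans (m≤n⇒m⊓n≡m (≮⇒≥ n≮b)) (sym (m≤n⇒m⊓n≡m (m≤n⇒m≤1+n (≮⇒≥ n≮b)))))

count-oneTo-between : ∀ n b → b ≤ n → count (λ v → (1 ≤? v) ×-dec (v ≤? b)) (oneTo n) ≡ b
count-oneTo-between n b b≤n = begin
  count (λ v → (1 ≤? v) ×-dec (v ≤? b)) (oneTo n)            ≡⟨ count-map _ suc (upTo n) ⟩
  count (λ u → (1 ≤? suc u) ×-dec (suc u ≤? b)) (upTo n)     ≡⟨ count-cong _ (_<? b) (proj₂ , (s≤s z≤n ,_)) (upTo n) ⟩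
  count (_<? b) (upTo n)                                    ≡⟨ count-upTo-< n b ⟩
  b ⊓ n                                                     ≡⟨ m≤n⇒m⊓n≡m b≤n ⟩
  b                                                         ∎
  where open ≡-Reasoning

product-map-1 : {X : Set} (xs : List X) → product (map (λ _ → 1) xs) ≡ 1
product-map-1 []       = refl
product-map-1 (x ∷ xs) = trans (+-identityʳ _) (product-map-1 xs)

module ∏ = CommutativeMonoidSum *-1-commutativeMonoid

product≡∏ : ∀ {n} (h : Fin n → ℕ) → product (map h (allFin n)) ≡ ∏.sum h
product≡∏ {zero}  h = refl
product≡∏ {suc n} h = trans (cong product (map-allFin-suc h)) (cong (h zero *_) (product≡∏ (h ∘ suc)))

product-allFin-permute : ∀ {n} (h : Fin n → ℕ) (τ τ⁻¹ : Fin n → Fin n) →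
                         (∀ y → τ (τ⁻¹ y) ≡ y) → (∀ y → τ⁻¹ (τ y) ≡ y) →
                         product (map (h ∘ τ) (allFin n)) ≡ product (map h (allFin n))
product-allFin-permute h τ τ⁻¹ inverseˡ inverseʳ = begin
  product (map (h ∘ τ) (allFin _))  ≡⟨ product≡∏ (h ∘ τ) ⟩
  ∏.sum (h ∘ τ)                     ≡⟨ ∏.∑-permute h (permutation τ τ⁻¹ inverseˡ inverseʳ) ⟨
  ∏.sum h                           ≡⟨ product≡∏ h ⟨
  product (map h (allFin _))        ∎
  where open ≡-Reasoning

module Transversal {n : ℕ} (F : Family n) (t : Fin n → Fin n) (transversal : IsTransversal F t) where

  t-injective : ∀ {i j} → t i ≡ t j → i ≡ j
  t-injective = proj₁ transversal

  t∈F : ∀ i → t i ∈ F i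
  t∈F = proj₂ transversal

  t⁻¹ : Fin n → Fin n
  t⁻¹ y = proj₁ (injective⇒surjective t t-injective y)

  t∘t⁻¹ : ∀ y → t (t⁻¹ y) ≡ y
  t∘t⁻¹ y = proj₂ (injective⇒surjective t t-injective y)

  t⁻¹∘t : ∀ i → t⁻¹ (t i) ≡ i
  t⁻¹∘t i = t-injective (t∘t⁻¹ (t i))

  Admissible : Fin n → Pred ℕ 0ℓ
  Admissible j v = 1 ≤ v × v ≤ ∣ F (t⁻¹ j) ∣

  IsConfiguration≐AllValues : IsConfiguration F t ≐ AllValues Admissible
  IsConfiguration≐AllValues =
    (λ {f} (f≥1 , f≤∣F∣) j → f≥1 j , subst (λ y → f y ≤ ∣ F (t⁻¹ j) ∣) (t∘t⁻¹ j) (f≤∣F∣ (t⁻¹ j))) ,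
    (λ {f} admissible → proj₁ ∘ admissible ,
                        λ i → subst (λ k → f (t i) ≤ ∣ F k ∣) (t⁻¹∘t i) (proj₂ (admissible (t i))))

  count-configurations : count (isConfiguration? F t) (funs n (oneTo n)) ≡ prodSizes F
  count-configurations = begin
    count (isConfiguration? F t) (funs n (oneTo n))
      ≡⟨ count-cong _ (allValues? admissible?) IsConfiguration≐AllValues (funs n (oneTo n)) ⟩
    count (allValues? admissible?) (funs n (oneTo n))
      ≡⟨ count-funs-allValues n (oneTo n) admissible? ⟩
    product (map (λ j → count (admissible? j) (oneTo n)) (allFin n))
      ≡⟨ cong product (map-cong (λ j → count-oneTo-between n _ (∣p∣≤n (F (t⁻¹ j)))) (allFin n)) ⟩
    product (map (λ j → ∣ F (t⁻¹ j) ∣) (allFin n))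
      ≡⟨ product-allFin-permute (λ i → ∣ F i ∣) t⁻¹ t t⁻¹∘t t∘t⁻¹ ⟩
    prodSizes F
      ∎
    where
    open ≡-Reasoning
    admissible? : ∀ j → Decidable (Admissible j)
    admissible? j v = (1 ≤? v) ×-dec (v ≤? ∣ F (t⁻¹ j) ∣)

  module _ {m : ℕ} (σ : Fin n → Fin m) where

    ranks : Fin n → ℕ
    ranks j = rank σ (F (t⁻¹ j)) (t (t⁻¹ j))

    Satisfies≐ranks : (λ f → Satisfies F t f σ) ≐ AllValues (λ j v → v ≡ ranks j)
    Satisfies≐ranks =
      (λ {f} sat j → subst (λ y → f y ≡ ranks j) (t∘t⁻¹ j) (sym (proj₂ (sat (t⁻¹ j))))) ,
      (λ {f} f≡ranks i → ∈-image⁺ σ (F i) (t∈F i) ,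
                         sym (trans (f≡ranks (t i)) (cong (λ k → rank σ (F k) (t k)) (t⁻¹∘t i))))

    Satisfies⇒IsConfiguration : ∀ {f} → Satisfies F t f σ → IsConfiguration F t f
    Satisfies⇒IsConfiguration {f} sat = proj₂ IsConfiguration≐AllValues λ j →
      let f≡rank = proj₁ Satisfies≐ranks sat j in
      subst (1 ≤_) (sym f≡rank) (s≤s z≤n) ,
      subst (_≤ ∣ F (t⁻¹ j) ∣) (sym f≡rank) (rank≤∣P∣ σ (F (t⁻¹ j)) (t∈F (t⁻¹ j)))

    count-satisfied : count (λ f → isSurjective? σ ×-dec satisfies? F t f σ) (funs n (oneTo n)) ≡ 𝟙 (isSurjective? σ)
    count-satisfied with isSurjective? σ
    ... | no ¬onto = count-none _ (funs n (oneTo n)) (All.tabulate λ _ (onto , _) → ¬onto onto)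
    ... | yes onto = begin
      count (λ f → yes onto ×-dec satisfies? F t f σ) (funs n (oneTo n))
        ≡⟨ count-cong _ (allValues? λ j v → v ≟ℕ ranks j)
                      (proj₁ Satisfies≐ranks ∘ proj₂ , (onto ,_) ∘ proj₂ Satisfies≐ranks) (funs n (oneTo n)) ⟩
      count (allValues? λ j v → v ≟ℕ ranks j) (funs n (oneTo n))
        ≡⟨ count-funs-allValues n (oneTo n) (λ j v → v ≟ℕ ranks j) ⟩
      product (map (λ j → count (_≟ℕ ranks j) (oneTo n)) (allFin n))
        ≡⟨ cong product (map-cong ranks-once (allFin n)) ⟩
      product (map (λ _ → 1) (allFin n))
        ≡⟨ product-map-1 (allFin n) ⟩
      1 ∎
      where
      open ≡-Reasoning
      ranks-once : ∀ j → count (_≟ℕ ranks j) (oneTo n) ≡ 1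
      ranks-once j = count-unique≡1 (_≟ℕ ranks j) (map⁺ suc-injective (upTo⁺ n)) (λ x≡ y≡ → trans x≡ (sym y≡))
                                    (∈-map⁺ suc (∈-upTo⁺ rank≤n)) refl
        where
        rank≤n : ranks j ≤ n
        rank≤n = ≤-trans (rank≤∣P∣ σ (F (t⁻¹ j)) (t∈F (t⁻¹ j))) (∣p∣≤n (F (t⁻¹ j)))

  module _ (m : ℕ) where

    private
      R? : ∀ f (σ : Fin n → Fin m) → Dec (IsSurjective σ × Satisfies F t f σ)
      R? f σ = isSurjective? σ ×-dec satisfies? F t f σ

    A≡0-outside : ∀ {f} → ¬ (IsConfiguration F t f × 1 ≤ A m F t f) → A m F t f ≡ 0
    A≡0-outside {f} f∉X with isConfiguration? F t f
    ... | yes conf = n<1⇒n≡0 (≰⇒> λ 1≤A → f∉X (conf , 1≤A))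
    ... | no ¬conf = count-none (R? f) (funs n (allFin m))
                                (All.tabulate λ _ (_ , sat) → ¬conf (Satisfies⇒IsConfiguration _ sat))

    sum-A : sum (map (A m F t) (configsX m F t)) ≡ m ! * stirling2 n m
    sum-A = begin
      sum (map (A m F t) (configsX m F t))
        ≡⟨ sum-map-filter _ (A m F t) (funs n (oneTo n)) A≡0-outside ⟩
      sum (map (λ f → count (R? f) (funs n (allFin m))) (funs n (oneTo n)))
        ≡⟨ double-count R? (funs n (oneTo n)) (funs n (allFin m)) ⟩
      sum (map (λ σ → count (λ f → R? f σ) (funs n (oneTo n))) (funs n (allFin m)))
        ≡⟨ cong sum (map-cong count-satisfied (funs n (allFin m))) ⟩
      sum (map (λ σ → 𝟙 (isSurjective? σ)) (funs n (allFin m)))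
        ≡⟨ sum-map-𝟙 isSurjective? (funs n (allFin m)) ⟩
      count isSurjective? (funs n (allFin m))
        ≡⟨ count-surjective n m ⟩
      m ! * stirling2 n m
        ∎
      where open ≡-Reasoning

    1≤A : ∀ f {σ : Fin n → Fin m} → IsSurjective σ → Satisfies F t f σ → 1 ≤ A m F t f
    1≤A f {σ} onto sat with ∈-funs n σ (λ j → ∈-allFin (σ j))
    ... | σ′ , σ′∈ , σ′≗σ = count-pos (R? f) σ′∈ ( IsSurjective-resp-≗ (sym ∘ σ′≗σ) onto
                                                  , Satisfies-resp-≗ (sym ∘ σ′≗σ) F t f sat)

    length-configsX : (∀ {f} → IsConfiguration F t f → 1 ≤ A m F t f) → length (configsX m F t) ≡ prodSizes F
    length-configsX achievable = begin
      count (λ f → isConfiguration? F t f ×-dec (1 ≤? A m F t f)) (funs n (oneTo n))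
        ≡⟨ count-cong _ (isConfiguration? F t) (proj₁ , λ conf → conf , achievable conf) (funs n (oneTo n)) ⟩
      count (isConfiguration? F t) (funs n (oneTo n))
        ≡⟨ count-configurations ⟩
      prodSizes F
        ∎
      where open ≡-Reasoning

odd-mono-< : ∀ {a b} → a < b → suc (2 * a) < suc (2 * b)
odd-mono-< a<b = s≤s (*-monoʳ-< 2 a<b)

odd-cancel-< : ∀ {a b} → suc (2 * a) < suc (2 * b) → a < b
odd-cancel-< {a} {b} lt = *-cancelˡ-< 2 a b (s≤s⁻¹ lt)

odd-injective : ∀ {a b} → suc (2 * a) ≡ suc (2 * b) → a ≡ b
odd-injective {a} {b} eq = *-cancelˡ-≡ a b 2 (suc-injective eq)

odd<even⁺ : ∀ {a w} → a < w → suc (2 * a) < 2 * w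
odd<even⁺ {a} {w} a<w = subst (_≤ 2 * w) (*-suc 2 a) (*-monoʳ-≤ 2 a<w)

odd<even⁻ : ∀ {a w} → suc (2 * a) < 2 * w → a < w
odd<even⁻ lt = ≰⇒> λ w≤a → <⇒≱ lt (m≤n⇒m≤1+n (*-monoʳ-≤ 2 w≤a))

discrete-intermediate-value : (g : ℕ → ℕ) → g 0 ≡ 0 → (∀ w → g (suc w) ≤ suc (g w)) →
                              ∀ {c} b → c ≤ g b → ∃ λ w → g w ≡ c
discrete-intermediate-value g g0≡0 _ zero c≤g0 = 0 , trans g0≡0 (sym (n≤0⇒n≡0 (subst (_ ≤_) g0≡0 c≤g0)))
discrete-intermediate-value g g0≡0 step {c} (suc b) c≤g[1+b] with c ≤? g b
... | yes c≤gb = discrete-intermediate-value g g0≡0 step b c≤gb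
... | no c≰gb  = suc b , ≤-antisym (≤-trans (step b) (≰⇒> c≰gb)) c≤g[1+b]

maximum-exists : ∀ {n} → Fin n → (v : Fin n → ℕ) → ∃ λ y → ∀ z → v z ≤ v y
maximum-exists y₀ v = argmax v y₀ (allFin _) , λ z → All.lookup (f[xs]≤f[argmax] y₀ (allFin _)) (∈-allFin z)

∈⋃⁺ : ∀ {n} {x : Fin n} {p} {ps : List (Subset n)} → p ∈ˡ ps → x ∈ p → x ∈ ⋃ ps
∈⋃⁺ (here refl) x∈p = x∈p∪q⁺ (inj₁ x∈p)
∈⋃⁺ (there p∈)  x∈p = x∈p∪q⁺ (inj₂ (∈⋃⁺ p∈ x∈p))

countBelow : ∀ {n} → (Fin n → ℕ) → Subset n → Fin n → ℕ
countBelow v P x = count (λ y → (y ∈? P) ×-dec (v y <? v x)) (allFin _)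

module Shelling {n : ℕ} (F : Family n) (π : Permutation′ n)
                (shelling : ∀ k → ∣ prefixUnion F π k ∣ ≡ suc (toℕ k))
                (t : Fin n → Fin n) (transversal : IsTransversal F t) where

  open Transversal F t transversal using (t-injective; t∈F; t⁻¹; t∘t⁻¹)

  member : Fin n → Subset n
  member k = F (π ⟨$⟩ʳ k)

  new : Fin n → Fin n
  new k = t (π ⟨$⟩ʳ k)

  new-injective : ∀ {k k′} → new k ≡ new k′ → k ≡ k′
  new-injective {k} {k′} eq = trans (sym (inverseˡ π)) (trans (cong (π ⟨$⟩ˡ_) (t-injective eq)) (inverseˡ π))

  new-surjective : ∀ y → ∃ λ k → new k ≡ y
  new-surjective y = π ⟨$⟩ˡ t⁻¹ y , trans (cong t (inverseʳ π)) (t∘t⁻¹ y)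

  member⊆prefixUnion : ∀ {k k′ y} → k′ Fin.≤ k → y ∈ member k′ → y ∈ prefixUnion F π k
  member⊆prefixUnion {k} {k′} k′≤k = ∈⋃⁺ (∈-map⁺ member (∈-filter⁺ (_≤ᶠ? k) (∈-allFin k′) k′≤k))

  -- The first k + 1 members of the shelling contain the k + 1 distinct elements new 0, …, new k and
  -- their union has only k + 1 elements, so it consists of exactly these.
  member⊆new≤ : ∀ {k y} → y ∈ member k → ∃ λ k′ → k′ Fin.≤ k × new k′ ≡ y
  member⊆new≤ {k} {y} y∈member with image? new (_≤ᶠ? k) y
  ... | yes y-new = y-new
  ... | no y-old  = contradiction (trans count-new (sym count-union)) (<⇒≢ new<union)
    where
    count-new : count (image? new (_≤ᶠ? k)) (allFin n) ≡ suc (toℕ k)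
    count-new = trans (count-image new (_≤ᶠ? k) (λ _ _ → new-injective)) (count-allFin-≤ k)
    count-union : count (_∈? prefixUnion F π k) (allFin n) ≡ suc (toℕ k)
    count-union = trans (sym (∣p∣≡count (prefixUnion F π k))) (shelling k)
    new<union : count (image? new (_≤ᶠ? k)) (allFin n) < count (_∈? prefixUnion F π k) (allFin n)
    new<union = count-mono-< (image? new (_≤ᶠ? k)) (_∈? prefixUnion F π k)
                  (λ (k′ , k′≤k , new≡) → subst (_∈ prefixUnion F π k) new≡ (member⊆prefixUnion k′≤k (t∈F _)))
                  (∈-allFin y) (member⊆prefixUnion {k} ≤-refl y∈member) y-old

  member⊆new< : ∀ {k y} → y ∈ member k → y ≢ new k → ∃ λ k′ → k′ Fin.< k × new k′ ≡ y
  member⊆new< {k} y∈member y≢new with member⊆new≤ y∈member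
  ... | k′ , k′≤k , new≡y =
    k′ , ≤∧≢⇒< k′≤k (λ k′≡k → y≢new (trans (sym new≡y) (cong new (toℕ-injective k′≡k)))) , new≡y

  module Ranked (c : Fin n → ℕ) (c<∣F∣ : ∀ i → c (t i) < ∣ F i ∣) where

    Placed : ℕ → Pred (Fin n) 0ℓ
    Placed s y = ∃ λ k → toℕ k < s × new k ≡ y

    record Valid (v : Fin n → ℕ) (s : ℕ) : Set where
      field
        injective : ∀ {y z} → Placed s y → Placed s z → v y ≡ v z → y ≡ z
        ranked    : ∀ k → toℕ k < s → countBelow v (member k) (new k) ≡ c (new k)

    module Step {s : ℕ} (s<n : s < n) {v : Fin n → ℕ} (valid : Valid v s) where

      open Valid valid

      k₀ : Fin n
      k₀ = fromℕ< s<n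

      Other : Pred (Fin n) 0ℓ
      Other y = y ∈ member k₀ × y ≢ new k₀

      other? : Decidable Other
      other? y = (y ∈? member k₀) ×-dec ¬? (y ≟ new k₀)

      Other⇒Placed : ∀ {y} → Other y → Placed s y
      Other⇒Placed (y∈ , y≢new) with member⊆new< y∈ y≢new
      ... | k′ , k′<k₀ , new≡y = k′ , subst (toℕ k′ <_) (toℕ-fromℕ< s<n) k′<k₀ , new≡y

      othersBelow : ℕ → ℕ
      othersBelow w = count (λ y → other? y ×-dec (v y <? w)) (allFin n)

      othersBelow-0 : othersBelow 0 ≡ 0
      othersBelow-0 = count-none _ (allFin n) (All.tabulate λ { _ (_ , ()) })

      -- v is injective on the placed elements, so at most one other element has value exactly w.
      othersBelow-suc : ∀ w → othersBelow (suc w) ≤ suc (othersBelow w)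
      othersBelow-suc w = begin
        othersBelow (suc w)
          ≡⟨ count-∩-∁ below? (λ y → v y <? w) (allFin n) ⟩
        count (below? ∩? (λ y → v y <? w)) (allFin n) + count (below? ∩? ∁? (λ y → v y <? w)) (allFin n)
          ≤⟨ +-mono-≤ (count-mono _ _ (λ ((other , _) , lt) → other , lt) (allFin n))
                      (count-unique≤1 _ (allFin⁺ n) value-w-unique) ⟩
        othersBelow w + 1
          ≡⟨ +-comm _ 1 ⟩
        suc (othersBelow w)
          ∎
        where
        open ≤-Reasoning
        below? : Decidable (λ y → Other y × v y < suc w)
        below? y = other? y ×-dec (v y <? suc w)
        value≡w : ∀ {y} → (Other y × v y < suc w) × ¬ v y < w → v y ≡ w
        value≡w ((_ , lt) , ≮) = ≤-antisym (s≤s⁻¹ lt) (≮⇒≥ ≮)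
        value-w-unique : ∀ {y z} → (Other y × v y < suc w) × ¬ v y < w → (Other z × v z < suc w) × ¬ v z < w → y ≡ z
        value-w-unique hy hz = injective (Other⇒Placed (proj₁ (proj₁ hy))) (Other⇒Placed (proj₁ (proj₁ hz)))
                                         (trans (value≡w hy) (sym (value≡w hz)))

      bound : ℕ
      bound = suc (v (proj₁ (maximum-exists k₀ v)))

      c≤othersBelow-bound : c (new k₀) ≤ othersBelow bound
      c≤othersBelow-bound = s≤s⁻¹ (begin
        suc (c (new k₀))
          ≤⟨ c<∣F∣ (π ⟨$⟩ʳ k₀) ⟩
        ∣ member k₀ ∣
          ≡⟨ ∣p∣≡count (member k₀) ⟩
        count (_∈? member k₀) (allFin n)
          ≡⟨ count-∩-∁ (_∈? member k₀) (_≟ new k₀) (allFin n) ⟩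
        count ((_∈? member k₀) ∩? (_≟ new k₀)) (allFin n) + count other? (allFin n)
          ≤⟨ +-monoˡ-≤ _ (count-unique≤1 _ (allFin⁺ n) (λ (_ , y≡new) (_ , z≡new) → trans y≡new (sym z≡new))) ⟩
        suc (count other? (allFin n))
          ≡⟨ cong suc (count-cong other? _ ((λ other → other , s≤s (proj₂ (maximum-exists k₀ v) _)) , proj₁)
                                  (allFin n)) ⟩
        suc (othersBelow bound)
          ∎)
        where open ≤-Reasoning

      opaque
        found : ∃ λ w → othersBelow w ≡ c (new k₀)
        found = discrete-intermediate-value othersBelow othersBelow-0 othersBelow-suc bound c≤othersBelow-bound

        w : ℕ
        w = proj₁ found

        othersBelow-w : othersBelow w ≡ c (new k₀)
        othersBelow-w = proj₂ found

      -- Placed elements keep their relative order on the odd numbers; the new element gets the even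
      -- value 2 w, which lies just above exactly c (new k₀) of the other elements of its member.
      v′ : Fin n → ℕ
      v′ y = if does (y ≟ new k₀) then 2 * w else suc (2 * v y)

      v′-new : v′ (new k₀) ≡ 2 * w
      v′-new rewrite dec-true (new k₀ ≟ new k₀) refl = refl

      v′-old : ∀ {y} → y ≢ new k₀ → v′ y ≡ suc (2 * v y)
      v′-old {y} y≢new rewrite dec-false (y ≟ new k₀) y≢new = refl

      Placed⇒≢new : ∀ {y} → Placed s y → y ≢ new k₀
      Placed⇒≢new (k , k<s , new≡y) y≡new =
        <-irrefl (trans (cong toℕ (new-injective (trans new≡y y≡new))) (toℕ-fromℕ< s<n)) k<s

      Placed-suc : ∀ {y} → Placed (suc s) y → Placed s y ⊎ y ≡ new k₀
      Placed-suc (k , k<1+s , new≡y) with m<1+n⇒m<n∨m≡n k<1+s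
      ... | inj₁ k<s = inj₁ (k , k<s , new≡y)
      ... | inj₂ k≡s = inj₂ (trans (sym new≡y) (cong new (toℕ-injective (trans k≡s (sym (toℕ-fromℕ< s<n))))))

      v′-old≢new : ∀ {y} → Placed s y → v′ y ≢ v′ (new k₀)
      v′-old≢new py eq = even≢odd w (v _) (trans (sym v′-new) (trans (sym eq) (v′-old (Placed⇒≢new py))))

      injective′ : ∀ {y z} → Placed (suc s) y → Placed (suc s) z → v′ y ≡ v′ z → y ≡ z
      injective′ py pz eq with Placed-suc py | Placed-suc pz
      ... | inj₁ oy   | inj₁ oz   = injective oy oz (odd-injective (trans (sym (v′-old (Placed⇒≢new oy)))
                                                                          (trans eq (v′-old (Placed⇒≢new oz)))))
      ... | inj₁ oy   | inj₂ refl = contradiction eq (v′-old≢new oy)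
      ... | inj₂ refl | inj₁ oz   = contradiction (sym eq) (v′-old≢new oz)
      ... | inj₂ refl | inj₂ refl = refl

      ranked-new : countBelow v′ (member k₀) (new k₀) ≡ c (new k₀)
      ranked-new = trans (count-cong _ _ (to , from) (allFin n)) othersBelow-w
        where
        to : ∀ {y} → y ∈ member k₀ × v′ y < v′ (new k₀) → Other y × v y < w
        to {y} (y∈ , lt) = (y∈ , y≢new) , odd<even⁻ (subst₂ _<_ (v′-old y≢new) v′-new lt)
          where
          y≢new : y ≢ new k₀
          y≢new y≡new = <-irrefl (cong v′ y≡new) lt
        from : ∀ {y} → Other y × v y < w → y ∈ member k₀ × v′ y < v′ (new k₀)
        from ((y∈ , y≢new) , lt) = y∈ , subst₂ _<_ (sym (v′-old y≢new)) (sym v′-new) (odd<even⁺ lt)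

      ranked-old : ∀ k → toℕ k < s → countBelow v′ (member k) (new k) ≡ c (new k)
      ranked-old k k<s = trans (count-cong _ _ (to , from) (allFin n)) (ranked k k<s)
        where
        v′-member : ∀ {y} → y ∈ member k → v′ y ≡ suc (2 * v y)
        v′-member y∈ with member⊆new≤ y∈
        ... | k′ , k′≤k , new≡y = v′-old (Placed⇒≢new (k′ , ≤-<-trans k′≤k k<s , new≡y))
        to : ∀ {y} → y ∈ member k × v′ y < v′ (new k) → y ∈ member k × v y < v (new k)
        to (y∈ , lt) = y∈ , odd-cancel-< (subst₂ _<_ (v′-member y∈) (v′-member (t∈F _)) lt)
        from : ∀ {y} → y ∈ member k × v y < v (new k) → y ∈ member k × v′ y < v′ (new k)
        from (y∈ , lt) = y∈ , subst₂ _<_ (sym (v′-member y∈)) (sym (v′-member (t∈F _))) (odd-mono-< lt)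

      ranked′ : ∀ k → toℕ k < suc s → countBelow v′ (member k) (new k) ≡ c (new k)
      ranked′ k k<1+s with m<1+n⇒m<n∨m≡n k<1+s
      ... | inj₁ k<s = ranked-old k k<s
      ... | inj₂ k≡s = subst (λ k → countBelow v′ (member k) (new k) ≡ c (new k))
                             (toℕ-injective (trans (toℕ-fromℕ< s<n) (sym k≡s))) ranked-new

      valid′ : Valid v′ (suc s)
      valid′ = record { injective = injective′ ; ranked = ranked′ }

    valid : ∀ s → s ≤ n → ∃ λ v → Valid v s
    valid zero    _   = (λ _ → 0) , record { injective = λ { (_ , () , _) } ; ranked = λ _ () }
    valid (suc s) s<n = let (v , v-valid) = valid s (<⇒≤ s<n) in Step.v′ s<n v-valid , Step.valid′ s<n v-valid

    ranked-valuation : ∃ λ V → (∀ {y z} → V y ≡ V z → y ≡ z) × (∀ i → countBelow V (F i) (t i) ≡ c (t i))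
    ranked-valuation = V , (λ eq → Valid.injective V-valid (placed _) (placed _) eq) , ranked
      where
      V : Fin n → ℕ
      V = proj₁ (valid n ≤-refl)
      V-valid : Valid V n
      V-valid = proj₂ (valid n ≤-refl)
      placed : ∀ y → Placed n y
      placed y = let (k , new≡y) = new-surjective y in k , toℕ<n k , new≡y
      ranked : ∀ i → countBelow V (F i) (t i) ≡ c (t i)
      ranked i = subst (λ j → countBelow V (F j) (t j) ≡ c (t j)) (inverseʳ π)
                       (Valid.ranked V-valid (π ⟨$⟩ˡ i) (toℕ<n _))

_∈ˡ?_ : ∀ {n} (x : Fin n) (xs : List (Fin n)) → Dec (x ∈ˡ xs)
x ∈ˡ? xs = Any.any? (x ≟_) xs

count-∈-unique : ∀ {n} {C : List (Fin n)} → Unique C → count (_∈ˡ? C) (allFin n) ≡ length C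
count-∈-unique {n} {[]} [] = count-none _ (allFin n) (All.tabulate λ _ ())
count-∈-unique {n} {a ∷ C} (a∉C ∷ unique) = begin
  count (_∈ˡ? (a ∷ C)) (allFin n)
    ≡⟨ count-cong _ ((_≟ a) ∪? (_∈ˡ? C)) (split , join) (allFin n) ⟩
  count ((_≟ a) ∪? (_∈ˡ? C)) (allFin n)
    ≡⟨ count-∪-disjoint (_≟ a) (_∈ˡ? C) (λ { refl a∈C → All.lookup a∉C a∈C refl }) (allFin n) ⟩
  count (_≟ a) (allFin n) + count (_∈ˡ? C) (allFin n)
    ≡⟨ cong₂ _+_ a-once (count-∈-unique unique) ⟩
  suc (length C)
    ∎
  where
  open ≡-Reasoning
  split : ∀ {y} → y ∈ˡ a ∷ C → y ≡ a ⊎ y ∈ˡ C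
  split (here y≡a) = inj₁ y≡a
  split (there y∈C) = inj₂ y∈C
  join : ∀ {y} → y ≡ a ⊎ y ∈ˡ C → y ∈ˡ a ∷ C
  join (inj₁ y≡a) = here y≡a
  join (inj₂ y∈C) = there y∈C
  a-once : count (_≟ a) (allFin n) ≡ 1
  a-once = count-unique≡1 (_≟ a) (allFin⁺ n) (λ y≡a z≡a → trans y≡a (sym z≡a)) (∈-allFin a) refl

n∸s+1≤m∧s≤1+l⇒n∸m≤l : ∀ n s m l → n ∸ s + 1 ≤ m → s ≤ suc l → n ∸ m ≤ l
n∸s+1≤m∧s≤1+l⇒n∸m≤l n s m l lower s≤1+l = m≤n+o⇒m∸n≤o n m (begin
  n                 ≤⟨ m≤n+m∸n n s ⟩
  s + (n ∸ s)       ≤⟨ +-monoˡ-≤ (n ∸ s) s≤1+l ⟩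
  suc l + (n ∸ s)   ≡⟨ rearrange l (n ∸ s) ⟩
  (n ∸ s + 1) + l   ≤⟨ +-monoˡ-≤ l lower ⟩
  m + l             ∎)
  where
  open ≤-Reasoning
  rearrange : ∀ l d → suc l + d ≡ d + 1 + l
  rearrange = solve-∀

module Merge {n : ℕ} (F : Family n) (t : Fin n → Fin n) (transversal : IsTransversal F t)
             (V : Fin n → ℕ) (V-injective : ∀ {y z} → V y ≡ V z → y ≡ z)
             (m : ℕ) (m-lower : n ∸ ∣ S F ∣ + 1 ≤ m) (m≤n : m ≤ n) where

  open Transversal F t transversal using (t∈F; t⁻¹; t∘t⁻¹)

  0<n : 0 < n
  0<n = ≤-trans (m+n≤o⇒n≤o (n ∸ ∣ S F ∣) m-lower) m≤n

  top : Fin n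
  top = proj₁ (maximum-exists (fromℕ< 0<n) V)

  V≤V-top : ∀ y → V y ≤ V top
  V≤V-top = proj₂ (maximum-exists (fromℕ< 0<n) V)

  Candidate : Pred (Fin n) 0ℓ
  Candidate y = y ∈ S F × y ≢ top

  candidate? : Decidable Candidate
  candidate? y = (y ∈? S F) ×-dec ¬? (y ≟ top)

  collapsed : List (Fin n)
  collapsed = take (n ∸ m) (filter candidate? (allFin n))

  collapsed⊆Candidate : ∀ {y} → y ∈ˡ collapsed → Candidate y
  collapsed⊆Candidate y∈ = proj₂ (∈-filter⁻ candidate? {xs = allFin n} (Any-resp-⊆ (take-⊆ (n ∸ m) _) y∈))

  collapsed-unique : Unique collapsed
  collapsed-unique = take⁺ (n ∸ m) (filter⁺ candidate? (allFin⁺ n))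

  length-collapsed : length collapsed ≡ n ∸ m
  length-collapsed =
    trans (length-take (n ∸ m) _) (m≤n⇒m⊓n≡m (n∸s+1≤m∧s≤1+l⇒n∸m≤l n ∣ S F ∣ m _ m-lower ∣S∣≤1+candidates))
    where
    open ≤-Reasoning
    ∣S∣≤1+candidates : ∣ S F ∣ ≤ suc (count candidate? (allFin n))
    ∣S∣≤1+candidates = begin
      ∣ S F ∣                                                             ≡⟨ ∣p∣≡count (S F) ⟩
      count (_∈? S F) (allFin n)                                          ≡⟨ count-∩-∁ (_∈? S F) (_≟ top) (allFin n) ⟩
      count ((_∈? S F) ∩? (_≟ top)) (allFin n) + count candidate? (allFin n)
        ≤⟨ +-monoˡ-≤ _ (count-unique≤1 _ (allFin⁺ n) (λ (_ , y≡top) (_ , z≡top) → trans y≡top (sym z≡top))) ⟩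
      suc (count candidate? (allFin n))                                   ∎

  Kept : Pred (Fin n) 0ℓ
  Kept y = ¬ y ∈ˡ collapsed

  kept? : Decidable Kept
  kept? = ∁? (_∈ˡ? collapsed)

  count-kept : count kept? (allFin n) ≡ m
  count-kept = begin
    count kept? (allFin n)
      ≡⟨ m+n∸m≡n (count (_∈ˡ? collapsed) (allFin n)) _ ⟨
    count (_∈ˡ? collapsed) (allFin n) + count kept? (allFin n) ∸ count (_∈ˡ? collapsed) (allFin n)
      ≡⟨ cong₂ _∸_ (trans (count+count-∁ _ (allFin n)) (length-tabulate {n = n} (λ i → i)))
                   (trans (count-∈-unique collapsed-unique) length-collapsed) ⟩
    n ∸ (n ∸ m)
      ≡⟨ m∸[m∸n]≡n m≤n ⟩
    m ∎
    where open ≡-Reasoning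

  top-kept : Kept top
  top-kept top∈ = proj₂ (collapsed⊆Candidate top∈) refl

  -- An element of S lies only in the member whose transversal element it is.
  member-kept : ∀ {i y} → y ∈ F i → y ≢ t i → Kept y
  member-kept {i} {y} y∈F y≢t y∈collapsed = y≢t (trans (sym (t∘t⁻¹ y)) (cong t (sym i≡t⁻¹y)))
    where
    once : occurrences F y ≡ 1
    once = ∈-tabulate⌊⌋⁻ (λ k → occurrences F k ≟ℕ 1) (proj₁ (collapsed⊆Candidate y∈collapsed))
    i≡t⁻¹y : i ≡ t⁻¹ y
    i≡t⁻¹y = count-allFin≡1⇒unique (λ i′ → y ∈? F i′) once y∈F
                                   (subst (_∈ F (t⁻¹ y)) (t∘t⁻¹ y) (t∈F (t⁻¹ y)))

  -- σ y is the number of kept elements below y: kept elements keep their order, and a collapsed element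
  -- is merged with the next kept element above it, which exists as top is kept.
  keptBelow : Fin n → ℕ
  keptBelow y = count (kept? ∩? (λ z → V z <? V y)) (allFin n)

  keptBelow<m : ∀ y → keptBelow y < m
  keptBelow<m y = subst (keptBelow y <_) count-kept
    (count-mono-< _ kept? proj₁ (∈-allFin top) top-kept (λ (_ , V-top<V-y) → <⇒≱ V-top<V-y (V≤V-top y)))

  keptBelow-mono : ∀ {j x} → Kept j → V j < V x → keptBelow j < keptBelow x
  keptBelow-mono {j} kept-j Vj<Vx = count-mono-< _ _ (λ (kept , lt) → kept , <-trans lt Vj<Vx) (∈-allFin j)
                                      (kept-j , Vj<Vx) (λ (_ , Vj<Vj) → <-irrefl refl Vj<Vj)

  keptBelow-cancel : ∀ {j x} → keptBelow j < keptBelow x → V j < V x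
  keptBelow-cancel lt =
    ≰⇒> λ Vx≤Vj → <⇒≱ lt (count-mono _ _ (λ (kept , lt′) → kept , <-≤-trans lt′ Vx≤Vj) (allFin n))

  opaque
    σ : Fin n → Fin m
    σ y = fromℕ< (keptBelow<m y)

    toℕ-σ : ∀ y → toℕ (σ y) ≡ keptBelow y
    toℕ-σ y = toℕ-fromℕ< (keptBelow<m y)

  σ-injective : InjectiveOn σ Kept
  σ-injective {j} {z} kept-j kept-z σj≡σz with <-cmp (V j) (V z)
  ... | tri< lt _ _ = contradiction keptBelow-j≡z (<⇒≢ (keptBelow-mono kept-j lt))
    where keptBelow-j≡z = trans (sym (toℕ-σ j)) (trans (cong toℕ σj≡σz) (toℕ-σ z))
  ... | tri≈ _ eq _ = V-injective eq
  ... | tri> _ _ gt = contradiction (sym keptBelow-j≡z) (<⇒≢ (keptBelow-mono kept-z gt))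
    where keptBelow-j≡z = trans (sym (toℕ-σ j)) (trans (cong toℕ σj≡σz) (toℕ-σ z))

  σ-surjective : IsSurjective σ
  σ-surjective v with count-image≡⇒surjective σ kept? (trans (count-image σ kept? σ-injective) count-kept) v
  ... | j , _ , σj≡v = j , σj≡v

  σ-rank : ∀ i → ∣ image σ (F i) ∩ below (σ (t i)) ∣ ≡ countBelow V (F i) (t i)
  σ-rank i = begin
    ∣ image σ (F i) ∩ below (σ x) ∣                        ≡⟨ ∣p∣≡count (image σ (F i) ∩ below (σ x)) ⟩
    count (_∈? (image σ (F i) ∩ below (σ x))) (allFin m)   ≡⟨ count-cong _ (image? σ lower?) (to , from) (allFin m) ⟩
    count (image? σ lower?) (allFin m)
      ≡⟨ count-image σ lower? (λ lj lz → σ-injective (Lower⇒Kept lj) (Lower⇒Kept lz)) ⟩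
    count lower? (allFin n)                                ≡⟨ count-cong lower? _ (Lower⇒below , below⇒Lower) (allFin n) ⟩
    countBelow V (F i) x                                   ∎
    where
    open ≡-Reasoning
    x : Fin n
    x = t i
    Lower : Pred (Fin n) 0ℓ
    Lower y = y ∈ F i × keptBelow y < keptBelow x
    lower? : Decidable Lower
    lower? y = (y ∈? F i) ×-dec (keptBelow y <? keptBelow x)
    Lower⇒Kept : ∀ {y} → Lower y → Kept y
    Lower⇒Kept (y∈ , lt) = member-kept y∈ λ y≡x → <-irrefl (cong keptBelow y≡x) lt
    Lower⇒below : ∀ {y} → Lower y → y ∈ F i × V y < V x
    Lower⇒below (y∈ , lt) = y∈ , keptBelow-cancel lt
    below⇒Lower : ∀ {y} → y ∈ F i × V y < V x → Lower y
    below⇒Lower (y∈ , lt) = y∈ , keptBelow-mono (member-kept y∈ λ y≡x → <-irrefl (cong V y≡x) lt) lt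
    to : ∀ {v} → v ∈ image σ (F i) ∩ below (σ x) → Image σ Lower v
    to {v} v∈ with x∈p∩q⁻ (image σ (F i)) _ v∈
    ... | v∈image , v∈below with ∈-image⁻ σ (F i) v∈image
    ...   | j , j∈ , refl = j , (j∈ , subst₂ _<_ (toℕ-σ j) (toℕ-σ x) (∈-tabulate⌊⌋⁻ (_<ᶠ? σ x) v∈below)) , refl
    from : ∀ {v} → Image σ Lower v → v ∈ image σ (F i) ∩ below (σ x)
    from (j , (j∈ , lt) , refl) =
      x∈p∩q⁺ ( ∈-image⁺ σ (F i) j∈
             , ∈-tabulate⌊⌋⁺ (_<ᶠ? σ x) (subst₂ _<_ (sym (toℕ-σ j)) (sym (toℕ-σ x)) lt))

configuration-satisfiable : ∀ {n} (F : Family n) → Shellable F → (t : Fin n → Fin n) → IsTransversal F t →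
                            ∀ m → n ∸ ∣ S F ∣ + 1 ≤ m → m ≤ n →
                            ∀ f → IsConfiguration F t f →
                            ∃ λ (σ : Fin n → Fin m) → IsSurjective σ × Satisfies F t f σ
configuration-satisfiable {n} F (π , shelling) t transversal m m-lower m≤n f (f≥1 , f≤∣F∣) =
  σ , σ-surjective , λ i → ∈-image⁺ σ (F i) (t∈F i) , trans (cong suc (trans (σ-rank i) (ranked i))) (suc-pred-f i)
  where
  open Transversal F t transversal using (t∈F)
  suc-pred-f : ∀ i → suc (pred (f (t i))) ≡ f (t i)
  suc-pred-f i = suc-pred (f (t i)) {{>-nonZero (f≥1 (t i))}}
  open Shelling.Ranked F π shelling t transversal (pred ∘ f)
                       (λ i → subst (_≤ ∣ F i ∣) (sym (suc-pred-f i)) (f≤∣F∣ i))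
  V : Fin n → ℕ
  V = proj₁ ranked-valuation
  ranked : ∀ i → countBelow V (F i) (t i) ≡ pred (f (t i))
  ranked = proj₂ (proj₂ ranked-valuation)
  open Merge F t transversal V (proj₁ (proj₂ ranked-valuation)) m m-lower m≤n

theorem3p27 : (n : ℕ) (F : Family n) → Shellable F
            → (t : Fin n → Fin n) → IsTransversal F t
            → (m : ℕ) → n ∸ ∣ S F ∣ + 1 ≤ m → m ≤ n
            → average m F t ≡ ((m !) * stirling2 n m) /ℕ prodSizes F
theorem3p27 n F shellable t transversal m m-lower m≤n = cong₂ _/ℕ_ (sum-A m) (length-configsX m achievable)
  where
  open Transversal F t transversal
  achievable : ∀ {f} → IsConfiguration F t f → 1 ≤ A m F t f
  achievable {f} conf =
    let (σ , onto , sat) = configuration-satisfiable F shellable t transversal m m-lower m≤n f conf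
    in 1≤A m f onto sat
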